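{- Let $F$ be a non-archimedean ordered field, $\mathcal{C}$ the set of all convex subgroups of $(F,+)$, and $Q=\{a+A: a\in F, A\in\mathcal{C}\}$, with multiplication $(a+A)(b+B)=ab+aB+bA+AB$. Then $Q\setminus\mathcal{C}$ is closed under this multiplication and $(Q\setminus\mathcal{C},\cdot)$ is a completely regular commutative semigroup.
   Context: A subset of $F$ is convex if it contains every element lying between two of its elements. In the multiplication, sums and products of sets are elementwise ($aB=\{ay:y\in B\}$, $AB=\{xy:x\in A, y\in B\}$); the product does not depend on the representatives. Elements of $Q\setminus\mathcal{C}$ are called zeroless. A semigroup is completely regular if every element belongs to some subgroup of the semigroup (a subset which is a group under the semigroup operation, possibly with its own identity element). -}

module Defs where

open import Level using (Level; _⊔_; suc)
open import Data.Nat using (ℕ; zero) renaming (suc to sucℕ)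
open import Data.Product using (Σ; Σ-syntax; ∃; ∃-syntax; _×_; _,_; proj₁; proj₂)
open import Relation.Nullary using (¬_)
open import Relation.Unary using (Pred; _≐_)
open import Relation.Binary.PropositionalEquality using (_≡_; _≢_)
open import Relation.Binary.Structures using (IsTotalOrder)
open import Algebra.Structures using (IsCommutativeRing)

record OrderedField (c ℓ : Level) : Set (suc (c ⊔ ℓ)) where
  infixl 7 _*_
  infixl 6 _+_
  infix 4 _≤_
  field
    Carrier : Set c
    _≤_     : Carrier → Carrier → Set ℓ
    _+_     : Carrier → Carrier → Carrier
    _*_     : Carrier → Carrier → Carrier
    -_      : Carrier → Carrier
    0#      : Carrier
    1#      : Carrier
    isCommutativeRing : IsCommutativeRing _≡_ _+_ _*_ -_ 0# 1#
    0≢1     : 0# ≢ 1#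
    inverse : ∀ x → x ≢ 0# → ∃[ y ] (x * y ≡ 1#)
    isTotalOrder : IsTotalOrder _≡_ _≤_
    +-mono-≤ : ∀ {x y} z → x ≤ y → x + z ≤ y + z
    *-nonneg : ∀ {x y} → 0# ≤ x → 0# ≤ y → 0# ≤ x * y

  _<_ : Carrier → Carrier → Set (c ⊔ ℓ)
  x < y = (x ≤ y) × (x ≢ y)

  fromℕ : ℕ → Carrier
  fromℕ zero     = 0#
  fromℕ (sucℕ n) = 1# + fromℕ n

module _ {c ℓ : Level} (F : OrderedField c ℓ) where
  open OrderedField F

  NonArchimedean : Set (c ⊔ ℓ)
  NonArchimedean = ∃[ x ] (∀ (n : ℕ) → fromℕ n < x)

  Subset : Set (suc c)
  Subset = Pred Carrier c

  IsConvex : Subset → Set (c ⊔ ℓ)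
  IsConvex A = ∀ x y z → A x → A z → x ≤ y → y ≤ z → A y

  IsAddSubgroup : Subset → Set c
  IsAddSubgroup A = A 0# × (∀ x y → A x → A y → A (x + y)) × (∀ x → A x → A (- x))

  IsConvexSubgroup : Subset → Set (c ⊔ ℓ)
  IsConvexSubgroup A = IsAddSubgroup A × IsConvex A

  ｛_｝ : Carrier → Subset
  ｛ a ｝ x = x ≡ a

  _⊕_ : Subset → Subset → Subset
  (S ⊕ T) x = ∃[ s ] ∃[ t ] (S s × T t × x ≡ s + t)

  _⊙_ : Carrier → Subset → Subset
  (a ⊙ B) x = ∃[ y ] (B y × x ≡ a * y)

  _⊗_ : Subset → Subset → Subset
  (A ⊗ B) x = ∃[ y ] ∃[ z ] (A y × B z × x ≡ y * z)

  coset : Carrier → Subset → Subset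
  coset a A = ｛ a ｝ ⊕ A

  cosetMul : Carrier → Subset → Carrier → Subset → Subset
  cosetMul a A b B = ((｛ a * b ｝ ⊕ (a ⊙ B)) ⊕ (b ⊙ A)) ⊕ (A ⊗ B)

  -- Zeroless elements of Q: sets a + A with A ∈ 𝒞 and a + A ∉ 𝒞,
  -- given with a chosen representative (a , A).
  Zeroless : Set (suc c ⊔ ℓ)
  Zeroless = Σ[ a ∈ Carrier ] Σ[ A ∈ Subset ]
               (IsConvexSubgroup A × ¬ IsConvexSubgroup (coset a A))

  toSet : Zeroless → Subset
  toSet (a , A , _) = coset a A

  _≈Z_ : Zeroless → Zeroless → Set c
  x ≈Z y = toSet x ≐ toSet y

  mulSet : Zeroless → Zeroless → Subset
  mulSet (a , A , _) (b , B , _) = cosetMul a A b B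

module _ {a ℓ : Level} {S : Set a} (_≈_ : S → S → Set ℓ) (_∙_ : S → S → S) where

  IsSubgroupOf : Pred S a → Set (a ⊔ ℓ)
  IsSubgroupOf G =
    (∀ g h → G g → G h → G (g ∙ h)) ×
    (∃[ e ] (G e ×
      (∀ g → G g → ((e ∙ g) ≈ g) × ((g ∙ e) ≈ g)) ×
      (∀ g → G g → ∃[ h ] (G h × ((g ∙ h) ≈ e) × ((h ∙ g) ≈ e)))))

  CompletelyRegular : Set (Level.suc a ⊔ ℓ)
  CompletelyRegular = ∀ x → ∃[ G ] (IsSubgroupOf G × G x)

module Submission where

-- A coset a + A with A ∈ 𝒞 is zeroless iff a ∉ A, and then every
-- y ∈ A satisfies |y| ≤ |a| (otherwise convexity would put a into A).
-- Consequently AB ⊆ aB for zeroless a + A, b + B, so the product set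
-- ab + aB + bA + AB is the coset ab + (aB + bA).  Convex subgroups are
-- closed under nonzero scaling and under sums, and a sum S + T of two of
-- them is "small": every w with |w| ≤ |s + t| already lies in S or in T;
-- this shows ab ∉ aB + bA, so the product is again zeroless.
-- Changing the representative a of a + A into a + α (α ∈ A) leaves the
-- product set unchanged, which makes the product well defined on sets;
-- commutativity and associativity are identities in F.  For complete
-- regularity, the cosets b + (b a⁻¹)A (b ≠ 0) form a subgroup containing
-- a + A, with identity 1 + a⁻¹A and inverses b⁻¹ + (b⁻¹ a⁻¹)A.

open import Level using (_⊔_; Lift; lift)
open import Defs
open import Data.Product using (Σ-syntax; ∃-syntax; _×_; _,_; proj₁; proj₂)
open import Data.Sum using (_⊎_; inj₁; inj₂)
open import Data.Empty using (⊥; ⊥-elim)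
open import Relation.Nullary using (¬_)
open import Relation.Unary using (Pred; _≐_; _⊆_)
open import Relation.Unary.Properties using (≐-refl; ≐-sym; ≐-trans)
open import Relation.Unary.Relation.Binary.Equality using (≐-isEquivalence)
import Relation.Binary.Construct.On as On
open import Relation.Binary.PropositionalEquality
open import Relation.Binary.Structures using (IsTotalOrder)
open import Algebra.Structures using (IsCommutativeRing; IsCommutativeSemigroup)
open import Algebra.Bundles using (CommutativeRing)

module ZerolessProduct {c ℓ} (F : OrderedField c ℓ) where
  open OrderedField F
  open IsCommutativeRing isCommutativeRing
    using ( +-assoc; +-comm; +-identityˡ; +-identityʳ; -‿inverseˡ; -‿inverseʳ
          ; *-assoc; *-comm; *-identityˡ; *-identityʳ; zeroʳ; distribˡ; distribʳ )
  open IsTotalOrder isTotalOrder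
    using (total; antisym) renaming (trans to ≤-trans; reflexive to ≤-reflexive)

  commutativeRing : CommutativeRing c c
  commutativeRing = record { isCommutativeRing = isCommutativeRing }

  open import Algebra.Properties.Ring (CommutativeRing.ring commutativeRing)
    using (-0#≈0#; -‿involutive; -‿+-comm; +-cancelˡ; +-inverseˡ-unique; -‿distribˡ-*; -‿distribʳ-*)
  open import Algebra.Properties.CommutativeSemigroup (CommutativeRing.+-commutativeSemigroup commutativeRing)
    using () renaming (interchange to +-interchange; xy∙z≈xz∙y to +-swapʳ)

  neg-+ : ∀ x y → - (x + y) ≡ - x + - y
  neg-+ x y = sym (-‿+-comm x y)

  x+y-y≡x : ∀ x y → (x + y) + - y ≡ x
  x+y-y≡x x y = trans (+-assoc x y (- y)) (trans (cong (x +_) (-‿inverseʳ y)) (+-identityʳ x))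

  x-y+y≡x : ∀ x y → (x + - y) + y ≡ x
  x-y+y≡x x y = trans (+-assoc x (- y) y) (trans (cong (x +_) (-‿inverseˡ y)) (+-identityʳ x))

  x+[-x+y]≡y : ∀ x y → x + (- x + y) ≡ y
  x+[-x+y]≡y x y = trans (sym (+-assoc x (- x) y)) (trans (cong (_+ y) (-‿inverseʳ x)) (+-identityˡ y))

  neg-*-neg : ∀ x y → - x * - y ≡ x * y
  neg-*-neg x y = trans (sym (-‿distribˡ-* x (- y)))
                        (trans (cong -_ (sym (-‿distribʳ-* x y))) (-‿involutive (x * y)))

  +-monoˡ-≤ : ∀ {x y} z → x ≤ y → z + x ≤ z + y
  +-monoˡ-≤ {x} {y} z x≤y = subst₂ _≤_ (+-comm x z) (+-comm y z) (+-mono-≤ z x≤y)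

  +-mono₂-≤ : ∀ {p q r s} → p ≤ q → r ≤ s → p + r ≤ q + s
  +-mono₂-≤ {q = q} {r = r} p≤q r≤s = ≤-trans (+-mono-≤ r p≤q) (+-monoˡ-≤ q r≤s)

  +-nonneg : ∀ {p q} → 0# ≤ p → 0# ≤ q → 0# ≤ p + q
  +-nonneg 0≤p 0≤q = subst (_≤ _) (+-identityʳ 0#) (+-mono₂-≤ 0≤p 0≤q)

  neg-anti : ∀ {x y} → x ≤ y → - y ≤ - x
  neg-anti {x} {y} x≤y = subst₂ _≤_ (x+[-x+y]≡y x (- y)) y-x-y≡-x (+-mono-≤ (- x + - y) x≤y)
    where
    y-x-y≡-x : y + (- x + - y) ≡ - x
    y-x-y≡-x = trans (cong (y +_) (+-comm (- x) (- y))) (x+[-x+y]≡y y (- x))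

  neg-nonneg : ∀ {x} → x ≤ 0# → 0# ≤ - x
  neg-nonneg x≤0 = subst (_≤ _) -0#≈0# (neg-anti x≤0)

  nonneg-neg : ∀ {x} → 0# ≤ x → - x ≤ 0#
  nonneg-neg 0≤x = subst (_ ≤_) -0#≈0# (neg-anti 0≤x)

  *-monoˡ-≤ : ∀ {k p q} → 0# ≤ k → p ≤ q → k * p ≤ k * q
  *-monoˡ-≤ {k} {p} {q} 0≤k p≤q =
    subst₂ _≤_ (+-identityˡ (k * p)) k[q-p]+kp≡kq (+-mono-≤ (k * p) 0≤k[q-p])
    where
    0≤k[q-p] : 0# ≤ k * (q + - p)
    0≤k[q-p] = *-nonneg 0≤k (subst (_≤ q + - p) (-‿inverseʳ p) (+-mono-≤ (- p) p≤q))
    k[q-p]+kp≡kq : k * (q + - p) + k * p ≡ k * q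
    k[q-p]+kp≡kq = trans (sym (distribˡ k (q + - p) p)) (cong (k *_) (x-y+y≡x q p))

  *-monoʳ-≤ : ∀ {k p q} → 0# ≤ k → p ≤ q → p * k ≤ q * k
  *-monoʳ-≤ {k} {p} {q} 0≤k p≤q = subst₂ _≤_ (*-comm k p) (*-comm k q) (*-monoˡ-≤ 0≤k p≤q)

  -- 0 ≤ 1, since otherwise 1 = (-1)(-1) would be a product of nonnegatives.
  0≤1 : 0# ≤ 1#
  0≤1 with total 0# 1#
  ... | inj₁ 0≤1 = 0≤1
  ... | inj₂ 1≤0 = subst (0# ≤_) (trans (neg-*-neg 1# 1#) (*-identityˡ 1#))
                         (*-nonneg (neg-nonneg 1≤0) (neg-nonneg 1≤0))

  abs : Carrier → Carrier
  abs x with total 0# x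
  ... | inj₁ _ = x
  ... | inj₂ _ = - x

  abs-cases : ∀ x → (abs x ≡ x × 0# ≤ x) ⊎ (abs x ≡ - x × x ≤ 0#)
  abs-cases x with total 0# x
  ... | inj₁ 0≤x = inj₁ (refl , 0≤x)
  ... | inj₂ x≤0 = inj₂ (refl , x≤0)

  abs-nonneg : ∀ x → 0# ≤ abs x
  abs-nonneg x with abs-cases x
  ... | inj₁ (e , 0≤x) = subst (0# ≤_) (sym e) 0≤x
  ... | inj₂ (e , x≤0) = subst (0# ≤_) (sym e) (neg-nonneg x≤0)

  ≤-abs : ∀ x → x ≤ abs x
  ≤-abs x with abs-cases x
  ... | inj₁ (e , _)   = ≤-reflexive (sym e)
  ... | inj₂ (_ , x≤0) = ≤-trans x≤0 (abs-nonneg x)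

  neg-≤-abs : ∀ x → - x ≤ abs x
  neg-≤-abs x with abs-cases x
  ... | inj₁ (_ , 0≤x) = ≤-trans (nonneg-neg 0≤x) (abs-nonneg x)
  ... | inj₂ (e , _)   = ≤-reflexive (sym e)

  abs-of-nonneg : ∀ {x} → 0# ≤ x → abs x ≡ x
  abs-of-nonneg {x} 0≤x with abs-cases x
  ... | inj₁ (e , _)   = e
  ... | inj₂ (e , x≤0) = trans e (trans (cong -_ x≡0) (trans -0#≈0# (sym x≡0)))
    where
    x≡0 : x ≡ 0#
    x≡0 = antisym x≤0 0≤x

  abs-of-nonpos : ∀ {x} → x ≤ 0# → abs x ≡ - x
  abs-of-nonpos {x} x≤0 with abs-cases x
  ... | inj₂ (e , _)   = e
  ... | inj₁ (e , 0≤x) = trans e (trans x≡0 (trans (sym -0#≈0#) (cong -_ (sym x≡0))))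
    where
    x≡0 : x ≡ 0#
    x≡0 = antisym x≤0 0≤x

  abs-lub : ∀ {x b} → x ≤ b → - x ≤ b → abs x ≤ b
  abs-lub {x} x≤b -x≤b with abs-cases x
  ... | inj₁ (e , _) = subst (_≤ _) (sym e) x≤b
  ... | inj₂ (e , _) = subst (_≤ _) (sym e) -x≤b

  triangle : ∀ x y → abs (x + y) ≤ abs x + abs y
  triangle x y = abs-lub (+-mono₂-≤ (≤-abs x) (≤-abs y))
                         (subst (_≤ abs x + abs y) (sym (neg-+ x y)) (+-mono₂-≤ (neg-≤-abs x) (neg-≤-abs y)))

  abs-neg : ∀ x → abs (- x) ≡ abs x
  abs-neg x with abs-cases x
  ... | inj₁ (e , 0≤x) = trans (abs-of-nonpos (nonneg-neg 0≤x)) (trans (-‿involutive x) (sym e))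
  ... | inj₂ (e , x≤0) = trans (abs-of-nonneg (neg-nonneg x≤0)) (sym e)

  abs-unique : ∀ {w z} → 0# ≤ z → z ≡ w ⊎ z ≡ - w → abs w ≡ z
  abs-unique 0≤z (inj₁ refl) = abs-of-nonneg 0≤z
  abs-unique {w} 0≤z (inj₂ refl) = trans (sym (abs-neg w)) (abs-of-nonneg 0≤z)

  -- |xy| = |x||y|: the right side is nonnegative and equals ±xy.
  abs-mul : ∀ x y → abs (x * y) ≡ abs x * abs y
  abs-mul x y = abs-unique (*-nonneg (abs-nonneg x) (abs-nonneg y))
                           (signs (sign x) (sign y))
    where
    sign : ∀ x → abs x ≡ x ⊎ abs x ≡ - x
    sign x with abs-cases x
    ... | inj₁ (e , _) = inj₁ e
    ... | inj₂ (e , _) = inj₂ e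
    signs : abs x ≡ x ⊎ abs x ≡ - x → abs y ≡ y ⊎ abs y ≡ - y →
            abs x * abs y ≡ x * y ⊎ abs x * abs y ≡ - (x * y)
    signs (inj₁ ex) (inj₁ ey) = inj₁ (cong₂ _*_ ex ey)
    signs (inj₁ ex) (inj₂ ey) = inj₂ (trans (cong₂ _*_ ex ey) (sym (-‿distribʳ-* x y)))
    signs (inj₂ ex) (inj₁ ey) = inj₂ (trans (cong₂ _*_ ex ey) (sym (-‿distribˡ-* x y)))
    signs (inj₂ ex) (inj₂ ey) = inj₁ (trans (cong₂ _*_ ex ey) (neg-*-neg x y))

  inv : (k : Carrier) → k ≢ 0# → Carrier
  inv k k≢0 = proj₁ (inverse k k≢0)

  inv-r : ∀ k (k≢0 : k ≢ 0#) → k * inv k k≢0 ≡ 1#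
  inv-r k k≢0 = proj₂ (inverse k k≢0)

  inv-l : ∀ k (k≢0 : k ≢ 0#) → inv k k≢0 * k ≡ 1#
  inv-l k k≢0 = trans (*-comm _ k) (inv-r k k≢0)

  *-inv-cancel : ∀ k (k≢0 : k ≢ 0#) z → k * (inv k k≢0 * z) ≡ z
  *-inv-cancel k k≢0 z = trans (sym (*-assoc k _ z)) (trans (cong (_* z) (inv-r k k≢0)) (*-identityˡ z))

  inv-*-cancel : ∀ k (k≢0 : k ≢ 0#) z → inv k k≢0 * (k * z) ≡ z
  inv-*-cancel k k≢0 z = trans (sym (*-assoc _ k z)) (trans (cong (_* z) (inv-l k k≢0)) (*-identityˡ z))

  *-cancelˡ : ∀ {k p q} (k≢0 : k ≢ 0#) → k * p ≡ k * q → p ≡ q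
  *-cancelˡ {k} {p} {q} k≢0 kp≡kq =
    trans (sym (inv-*-cancel k k≢0 p)) (trans (cong (inv k k≢0 *_) kp≡kq) (inv-*-cancel k k≢0 q))

  *-nonzero : ∀ {x y} → x ≢ 0# → y ≢ 0# → x * y ≢ 0#
  *-nonzero {x} {y} x≢0 y≢0 xy≡0 =
    y≢0 (trans (sym (inv-*-cancel x x≢0 y)) (trans (cong (inv x x≢0 *_) xy≡0) (zeroʳ _)))

  inv-nonzero : ∀ k (k≢0 : k ≢ 0#) → inv k k≢0 ≢ 0#
  inv-nonzero k k≢0 k⁻¹≡0 = 0≢1 (trans (sym (zeroʳ k)) (trans (cong (k *_) (sym k⁻¹≡0)) (inv-r k k≢0)))

  abs-inv : ∀ k (k≢0 : k ≢ 0#) → abs (inv k k≢0) * abs k ≡ 1#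
  abs-inv k k≢0 = trans (sym (abs-mul _ k)) (trans (cong abs (inv-l k k≢0)) (abs-of-nonneg 0≤1))

  Sub : Set (Level.suc c)
  Sub = Subset F

  infixl 6 _⊞_
  _⊞_ : Sub → Sub → Sub
  _⊞_ = _⊕_ F

  infixr 7 _⊡_
  _⊡_ : Carrier → Sub → Sub
  _⊡_ = _⊙_ F

  ⊞-cong : ∀ {S S' T T'} → S ≐ S' → T ≐ T' → S ⊞ T ≐ S' ⊞ T'
  ⊞-cong (f , f') (g , g') =
      (λ { (s , t , Ss , Tt , e) → s , t , f Ss , g Tt , e })
    , (λ { (s , t , Ss , Tt , e) → s , t , f' Ss , g' Tt , e })

  ⊞-comm : ∀ {S T} → S ⊞ T ⊆ T ⊞ S
  ⊞-comm (s , t , Ss , Tt , e) = t , s , Tt , Ss , trans e (+-comm s t)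

  ⊡-cong : ∀ k {S T} → S ≐ T → k ⊡ S ≐ k ⊡ T
  ⊡-cong k (f , g) = (λ { (y , Sy , e) → y , f Sy , e }) , (λ { (y , Ty , e) → y , g Ty , e })

  ⊡-≡ : ∀ {S k m} → k ≡ m → k ⊡ S ≐ m ⊡ S
  ⊡-≡ refl = ≐-refl

  ⊡-⊡ : ∀ {S} k m → k ⊡ (m ⊡ S) ≐ (k * m) ⊡ S
  ⊡-⊡ k m = (λ { (_ , (u , Su , refl) , refl) → u , Su , sym (*-assoc k m u) })
          , (λ { (u , Su , refl) → m * u , (u , Su , refl) , *-assoc k m u })

  1⊡ : ∀ {S} → 1# ⊡ S ≐ S
  1⊡ {S} = (λ { (y , Sy , refl) → subst S (sym (*-identityˡ y)) Sy })
         , (λ {x} Sx → x , Sx , sym (*-identityˡ x))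

  IsSG : Sub → Set c
  IsSG = IsAddSubgroup F

  ⊡-subgroup : ∀ {A} k → IsSG A → IsSG (k ⊡ A)
  ⊡-subgroup k (A0 , A+ , A-) =
      (0# , A0 , sym (zeroʳ k))
    , (λ { _ _ (u , Au , refl) (v , Av , refl) → u + v , A+ u v Au Av , sym (distribˡ k u v) })
    , (λ { _ (u , Au , refl) → - u , A- u Au , -‿distribʳ-* k u })

  ⊞-subgroup : ∀ {S T} → IsSG S → IsSG T → IsSG (S ⊞ T)
  ⊞-subgroup (S0 , S+ , S-) (T0 , T+ , T-) =
      (0# , 0# , S0 , T0 , sym (+-identityʳ 0#))
    , (λ { _ _ (s₁ , t₁ , Ss₁ , Tt₁ , refl) (s₂ , t₂ , Ss₂ , Tt₂ , refl) →
           s₁ + s₂ , t₁ + t₂ , S+ _ _ Ss₁ Ss₂ , T+ _ _ Tt₁ Tt₂ , +-interchange s₁ t₁ s₂ t₂ })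
    , (λ { _ (s , t , Ss , Tt , refl) → - s , - t , S- _ Ss , T- _ Tt , neg-+ s t })

  ⊞-absorb : ∀ {S T D} → IsSG D → S ≐ D → T ≐ D → S ⊞ T ≐ D
  ⊞-absorb (D0 , D+ , _) (f , f') (g , g') =
      (λ { (s , t , Ss , Tt , refl) → D+ s t (f Ss) (g Tt) })
    , (λ {x} Dx → x , 0# , f' Dx , g' D0 , sym (+-identityʳ x))

  -- Convex subgroups.  For a subgroup, convexity is equivalent to being
  -- closed downwards under |·|; the latter form is the one used throughout.

  IsCS : Sub → Set (c ⊔ ℓ)
  IsCS = IsConvexSubgroup F

  AbsClosed : Sub → Set (c ⊔ ℓ)
  AbsClosed A = ∀ {y z} → A y → abs z ≤ abs y → A z

  abs-mem : ∀ {A} → IsSG A → ∀ {y} → A y → A (abs y)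
  abs-mem {A} (_ , _ , A-) {y} Ay with abs-cases y
  ... | inj₁ (e , _) = subst A (sym e) Ay
  ... | inj₂ (e , _) = subst A (sym e) (A- y Ay)

  convex⇒absClosed : ∀ {A} → IsCS A → AbsClosed A
  convex⇒absClosed (sg@(_ , _ , A-) , convex) {y} {z} Ay |z|≤|y| =
    convex (- abs y) z (abs y) (A- _ (abs-mem sg Ay)) (abs-mem sg Ay) -|y|≤z z≤|y|
    where
    -|y|≤z : - abs y ≤ z
    -|y|≤z = ≤-trans (neg-anti |z|≤|y|) (subst (- abs z ≤_) (-‿involutive z) (neg-anti (neg-≤-abs z)))
    z≤|y| : z ≤ abs y
    z≤|y| = ≤-trans (≤-abs z) |z|≤|y|

  absClosed⇒convex : ∀ {A} → IsSG A → AbsClosed A → IsConvex F A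
  absClosed⇒convex {A} (_ , A+ , A-) closed x y z Ax Az x≤y y≤z =
    subst A (x-y+y≡x y x) (A+ _ _ (closed (A+ _ _ Az (A- _ Ax)) |y-x|≤|z-x|) Ax)
    where
    |y-x|≤|z-x| : abs (y + - x) ≤ abs (z + - x)
    |y-x|≤|z-x| = subst₂ _≤_ (sym (abs-of-nonneg (x≤w⇒0≤w-x x≤y))) (sym (abs-of-nonneg (x≤w⇒0≤w-x (≤-trans x≤y y≤z))))
                             (+-mono-≤ (- x) y≤z)
      where
      x≤w⇒0≤w-x : ∀ {w} → x ≤ w → 0# ≤ w + - x
      x≤w⇒0≤w-x {w} x≤w = subst (_≤ w + - x) (-‿inverseʳ x) (+-mono-≤ (- x) x≤w)

  double-bound : ∀ {S s w} → IsCS S → S s → abs w ≤ abs s + abs s → S w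
  double-bound {s = s} cs@(sg@(_ , S+ , _) , _) Ss |w|≤2|s| =
    convex⇒absClosed cs (S+ _ _ (abs-mem sg Ss) (abs-mem sg Ss))
      (subst (_ ≤_) (sym (abs-of-nonneg (+-nonneg (abs-nonneg s) (abs-nonneg s)))) |w|≤2|s|)

  -- Smallness of sums: anything bounded by |s + t| with s ∈ S, t ∈ T lies
  -- in S or in T, namely in the one holding the larger of s and t.
  dichotomy : ∀ {S T s t w} → IsCS S → IsCS T → S s → T t → abs w ≤ abs (s + t) → S w ⊎ T w
  dichotomy {S} {T} {s} {t} {w} csS csT Ss Tt |w|≤|s+t| = larger (total (abs s) (abs t))
    where
    |w|≤|s|+|t| : abs w ≤ abs s + abs t
    |w|≤|s|+|t| = ≤-trans |w|≤|s+t| (triangle s t)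
    larger : abs s ≤ abs t ⊎ abs t ≤ abs s → S w ⊎ T w
    larger (inj₁ |s|≤|t|) = inj₂ (double-bound csT Tt (≤-trans |w|≤|s|+|t| (+-mono-≤ (abs t) |s|≤|t|)))
    larger (inj₂ |t|≤|s|) = inj₁ (double-bound csS Ss (≤-trans |w|≤|s|+|t| (+-monoˡ-≤ (abs s) |t|≤|s|)))

  -- A nonzero multiple kA of a convex subgroup is one: |z| ≤ |ku| gives
  -- |k⁻¹z| ≤ |u|, so z = k(k⁻¹z) ∈ kA.
  ⊡-convex : ∀ {A} k → k ≢ 0# → IsCS A → IsCS (k ⊡ A)
  ⊡-convex {A} k k≢0 cs@(sg , _) = sg' , absClosed⇒convex sg' closed
    where
    sg' : IsSG (k ⊡ A)
    sg' = ⊡-subgroup k sg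
    k⁻¹ : Carrier
    k⁻¹ = inv k k≢0
    closed : AbsClosed (k ⊡ A)
    closed {z = z} (u , Au , refl) |z|≤|ku| =
      k⁻¹ * z , convex⇒absClosed cs Au |k⁻¹z|≤|u| , sym (*-inv-cancel k k≢0 z)
      where
      |k⁻¹||ku|≡|u| : abs k⁻¹ * abs (k * u) ≡ abs u
      |k⁻¹||ku|≡|u| = begin
        abs k⁻¹ * abs (k * u)      ≡⟨ cong (abs k⁻¹ *_) (abs-mul k u) ⟩
        abs k⁻¹ * (abs k * abs u)  ≡⟨ sym (*-assoc _ _ _) ⟩
        (abs k⁻¹ * abs k) * abs u  ≡⟨ cong (_* abs u) (abs-inv k k≢0) ⟩
        1# * abs u                 ≡⟨ *-identityˡ _ ⟩
        abs u                      ∎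
        where open ≡-Reasoning
      |k⁻¹z|≤|u| : abs (k⁻¹ * z) ≤ abs u
      |k⁻¹z|≤|u| = subst₂ _≤_ (sym (abs-mul k⁻¹ z)) |k⁻¹||ku|≡|u| (*-monoˡ-≤ (abs-nonneg k⁻¹) |z|≤|ku|)

  ⊞-convex : ∀ {S T} → IsCS S → IsCS T → IsCS (S ⊞ T)
  ⊞-convex {S} {T} csS@((S0 , _) , _) csT@((T0 , _) , _) = sg , absClosed⇒convex sg closed
    where
    sg : IsSG (S ⊞ T)
    sg = ⊞-subgroup (proj₁ csS) (proj₁ csT)
    closed : AbsClosed (S ⊞ T)
    closed {z = z} (s , t , Ss , Tt , refl) |z|≤|s+t| with dichotomy csS csT Ss Tt |z|≤|s+t|
    ... | inj₁ Sz = z , 0# , Sz , T0 , sym (+-identityʳ z)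
    ... | inj₂ Tz = 0# , z , S0 , Tz , sym (+-identityˡ z)

  convex-resp-≐ : ∀ {S T} → S ≐ T → IsCS S → IsCS T
  convex-resp-≐ (f , g) ((S0 , S+ , S-) , convex) =
      (f S0 , (λ x y Tx Ty → f (S+ x y (g Tx) (g Ty))) , (λ x Tx → f (S- x (g Tx))))
    , (λ x y z Tx Tz x≤y y≤z → f (convex x y z (g Tx) (g Tz) x≤y y≤z))

  coset-cong : ∀ {C C' x x'} → x ≡ x' → C ≐ C' → coset F x C ≐ coset F x' C'
  coset-cong refl (f , g) = (λ { (s , t , es , Ct , e) → s , t , es , f Ct , e })
                          , (λ { (s , t , es , Ct , e) → s , t , es , g Ct , e })

  coset-absorb : ∀ {D x d} → IsSG D → D d → coset F (x + d) D ≐ coset F x D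
  coset-absorb {x = x} {d} (_ , D+ , D-) Dd =
      (λ { (_ , t , refl , Dt , refl) → x , d + t , refl , D+ d t Dd Dt , +-assoc x d t })
    , (λ { (_ , t , refl , Dt , refl) →
           x + d , - d + t , refl , D+ _ t (D- d Dd) Dt
         , trans (cong (x +_) (sym (x+[-x+y]≡y d t))) (sym (+-assoc x d (- d + t))) })

  coset-self : ∀ {A a} → IsSG A → A a → coset F a A ≐ A
  coset-self {A} {a} sg@(A0 , _) Aa =
    ≐-trans (coset-cong (sym (+-identityˡ a)) ≐-refl)
            (≐-trans (coset-absorb {x = 0#} sg Aa) (fromZero , toZero))
    where
    fromZero : coset F 0# A ⊆ A
    fromZero (_ , t , refl , At , refl) = subst A (sym (+-identityˡ t)) At
    toZero : A ⊆ coset F 0# A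
    toZero {x} Ax = 0# , x , refl , Ax , sym (+-identityˡ x)

  zeroless⇒notin : ∀ {A a} → IsCS A → ¬ IsCS (coset F a A) → ¬ A a
  zeroless⇒notin cs@(sg , _) not-cs Aa = not-cs (convex-resp-≐ (≐-sym (coset-self sg Aa)) cs)

  notin⇒zeroless : ∀ {A a} → IsSG A → ¬ A a → ¬ IsCS (coset F a A)
  notin⇒zeroless {A} (_ , _ , A-) a∉A ((( _ , t , refl , At , 0≡a+t) , _) , _) =
    a∉A (subst A (sym (+-inverseˡ-unique _ t (sym 0≡a+t))) (A- t At))

  coset-≐ : ∀ {A A' a a'} → IsSG A → IsSG A' → coset F a A ≐ coset F a' A' →
            (A ≐ A') × ∃[ α ] (A' α × a ≡ a' + α)
  coset-≐ sgA sgA' (f , g) = (group-⊆ sgA sgA' f , group-⊆ sgA' sgA g) , shift sgA f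
    where
    shift : ∀ {A A' a a'} → IsSG A → coset F a A ⊆ coset F a' A' → ∃[ α ] (A' α × a ≡ a' + α)
    shift {a = a} (A0 , _) f with f (a , 0# , refl , A0 , sym (+-identityʳ a))
    ... | (_ , α , refl , A'α , a≡a'+α) = α , A'α , a≡a'+α
    group-⊆ : ∀ {A A' a a'} → IsSG A → IsSG A' → coset F a A ⊆ coset F a' A' → A ⊆ A'
    group-⊆ {A' = A'} {a} {a'} sgA (_ , A'+ , A'-) f {x} Ax
      with shift sgA f | f (a , x , refl , Ax , refl)
    ... | (α , A'α , refl) | (_ , t , refl , A't , a'+α+x≡a'+t) =
      subst A' (x+y-y≡x x α) (subst (λ u → A' (u + - α)) (trans (sym α+x≡t) (+-comm α x)) (A'+ t (- α) A't (A'- α A'α)))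
      where
      α+x≡t : α + x ≡ t
      α+x≡t = +-cancelˡ a' (α + x) t (trans (sym (+-assoc a' α x)) a'+α+x≡a'+t)

  Z : Set (Level.suc c ⊔ ℓ)
  Z = Zeroless F

  mkZ : (a : Carrier) (A : Sub) → IsCS A → ¬ A a → Z
  mkZ a A cs a∉A = a , A , cs , notin⇒zeroless (proj₁ cs) a∉A

  rep-nonzero : ∀ {A a} → IsSG A → ¬ A a → a ≢ 0#
  rep-nonzero {A} (A0 , _) a∉A a≡0 = a∉A (subst A (sym a≡0) A0)

  rep-bound : ∀ {A a y} → IsCS A → ¬ A a → A y → abs y ≤ abs a
  rep-bound {a = a} {y} cs a∉A Ay with total (abs y) (abs a)
  ... | inj₁ |y|≤|a| = |y|≤|a|
  ... | inj₂ |a|≤|y| = ⊥-elim (a∉A (convex⇒absClosed cs Ay |a|≤|y|))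

  -- Hence AB ⊆ aB: y z = a ((a⁻¹ y) z), and |a⁻¹ y| ≤ 1.
  AB⊆aB : ∀ {A B a y z} → IsCS A → ¬ A a → IsCS B → A y → B z → (a ⊡ B) (y * z)
  AB⊆aB {a = a} {y} {z} csA a∉A csB Ay Bz =
    (a⁻¹ * y) * z , convex⇒absClosed csB Bz |a⁻¹yz|≤|z| , sym a[a⁻¹yz]≡yz
    where
    a≢0 : a ≢ 0#
    a≢0 = rep-nonzero (proj₁ csA) a∉A
    a⁻¹ : Carrier
    a⁻¹ = inv a a≢0
    a[a⁻¹yz]≡yz : a * ((a⁻¹ * y) * z) ≡ y * z
    a[a⁻¹yz]≡yz = trans (sym (*-assoc a _ z)) (cong (_* z) (*-inv-cancel a a≢0 y))
    |a⁻¹y|≤1 : abs (a⁻¹ * y) ≤ 1#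
    |a⁻¹y|≤1 = subst₂ _≤_ (sym (abs-mul a⁻¹ y)) (abs-inv a a≢0)
                          (*-monoˡ-≤ (abs-nonneg a⁻¹) (rep-bound csA a∉A Ay))
    |a⁻¹yz|≤|z| : abs ((a⁻¹ * y) * z) ≤ abs z
    |a⁻¹yz|≤|z| = subst₂ _≤_ (sym (abs-mul _ z)) (*-identityˡ (abs z)) (*-monoʳ-≤ (abs-nonneg z) |a⁻¹y|≤1)

  -- aB only depends on the coset a + A: (c + α)B = cB for α ∈ A.
  shift-⊆ : ∀ {A B c α} → IsCS A → ¬ A c → IsCS B → A α → (c + α) ⊡ B ⊆ c ⊡ B
  shift-⊆ {B = B} {c} {α} csA c∉A csB Aα (y , By , refl) =
    subst (c ⊡ B) (sym (distribʳ y c α)) (c⊡B+ _ _ (y , By , refl) (AB⊆aB csA c∉A csB Aα By))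
    where
    c⊡B+ : ∀ u v → (c ⊡ B) u → (c ⊡ B) v → (c ⊡ B) (u + v)
    c⊡B+ = proj₁ (proj₂ (⊡-subgroup c (proj₁ csB)))

  shift-≐ : ∀ {A B c α} → IsCS A → ¬ A c → IsCS B → A α → (c + α) ⊡ B ≐ c ⊡ B
  shift-≐ {A} {B} {c} {α} csA@((_ , A+ , A-) , _) c∉A csB Aα = shift-⊆ csA c∉A csB Aα , back
    where
    c+α∉A : ¬ A (c + α)
    c+α∉A A[c+α] = c∉A (subst A (x+y-y≡x c α) (A+ _ _ A[c+α] (A- α Aα)))
    back : c ⊡ B ⊆ (c + α) ⊡ B
    back cy = shift-⊆ csA c+α∉A csB (A- α Aα) (proj₁ (⊡-≡ (sym (x+y-y≡x c α))) cy)

  prodGroup : Carrier → Sub → Carrier → Sub → Sub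
  prodGroup a A b B = a ⊡ B ⊞ b ⊡ A

  prodGroup-convex : ∀ {A B a b} → IsCS A → ¬ A a → IsCS B → ¬ B b → IsCS (prodGroup a A b B)
  prodGroup-convex csA a∉A csB b∉B =
    ⊞-convex (⊡-convex _ (rep-nonzero (proj₁ csA) a∉A) csB) (⊡-convex _ (rep-nonzero (proj₁ csB) b∉B) csA)

  -- ab ∉ aB + bA: by smallness of sums, ab would lie in aB (so b ∈ B) or
  -- in bA (so a ∈ A).
  prodGroup-avoids : ∀ {A B a b} → IsCS A → ¬ A a → IsCS B → ¬ B b → ¬ prodGroup a A b B (a * b)
  prodGroup-avoids {A} {B} {a} {b} csA a∉A csB b∉B (p , q , aBp , bAq , ab≡p+q) =
    excluded (dichotomy (⊡-convex a a≢0 csB) (⊡-convex b b≢0 csA) aBp bAq (≤-reflexive (cong abs ab≡p+q)))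
    where
    a≢0 : a ≢ 0#
    a≢0 = rep-nonzero (proj₁ csA) a∉A
    b≢0 : b ≢ 0#
    b≢0 = rep-nonzero (proj₁ csB) b∉B
    excluded : (a ⊡ B) (a * b) ⊎ (b ⊡ A) (a * b) → ⊥
    excluded (inj₁ (u , Bu , ab≡au)) = b∉B (subst B (sym (*-cancelˡ a≢0 ab≡au)) Bu)
    excluded (inj₂ (v , Av , ab≡bv)) = a∉A (subst A (sym (*-cancelˡ b≢0 (trans (*-comm b a) ab≡bv))) Av)

  rep∉group : (x : Z) → ¬ proj₁ (proj₂ x) (proj₁ x)
  rep∉group (_ , _ , cs , zeroless) = zeroless⇒notin cs zeroless

  infixl 7 _·_
  _·_ : Z → Z → Z
  x@(a , A , csA , _) · y@(b , B , csB , _) =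
    mkZ (a * b) (prodGroup a A b B)
        (prodGroup-convex csA (rep∉group x) csB (rep∉group y))
        (prodGroup-avoids csA (rep∉group x) csB (rep∉group y))

  toSet-· : ∀ x y → toSet F (x · y) ≐ mulSet F x y
  toSet-· x@(a , A , csA , _) (b , B , csB , _) = into , outof
    where
    into : coset F (a * b) (prodGroup a A b B) ⊆ cosetMul F a A b B
    into (s , _ , s≡ab , (p , q , aBp , bAq , refl) , refl) =
      (s + p) + q , 0# , ((s + p) , q , (s , p , s≡ab , aBp , refl) , bAq , refl)
      , (0# , 0# , proj₁ (proj₁ csA) , proj₁ (proj₁ csB) , sym (zeroʳ 0#))
      , trans (sym (+-assoc s p q)) (sym (+-identityʳ _))
    outof : cosetMul F a A b B ⊆ coset F (a * b) (prodGroup a A b B)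
    outof (_ , _ , (_ , q , (s , p , s≡ab , aBp , refl) , bAq , refl) , (u , v , Au , Bv , refl) , refl) =
      s , (p + u * v) + q , s≡ab
      , (p + u * v , q , aB+ _ _ aBp (AB⊆aB csA (rep∉group x) csB Au Bv) , bAq , refl)
      , regroup s p q (u * v)
      where
      aB+ : ∀ u v → (a ⊡ B) u → (a ⊡ B) v → (a ⊡ B) (u + v)
      aB+ = proj₁ (proj₂ (⊡-subgroup a (proj₁ csB)))
      regroup : ∀ s p q r → ((s + p) + q) + r ≡ s + ((p + r) + q)
      regroup s p q r =
        trans (cong (_+ r) (+-assoc s p q)) (trans (+-assoc s (p + q) r) (cong (s +_) (+-swapʳ p q r)))

  -- Changing the representative c of c + A to c + α leaves the product
  -- with b + B unchanged: (c + α)B = cB, and αb ∈ bA is absorbed.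
  change-rep : ∀ {A B c b α} → IsCS A → ¬ A c → IsCS B → A α →
               coset F ((c + α) * b) (prodGroup (c + α) A b B) ≐ coset F (c * b) (prodGroup c A b B)
  change-rep {A} {B} {c} {b} {α} csA c∉A csB Aα =
    ≐-trans (coset-cong (distribʳ b c α) (⊞-cong (shift-≐ csA c∉A csB Aα) ≐-refl))
            (coset-absorb (⊞-subgroup (⊡-subgroup c (proj₁ csB)) (⊡-subgroup b (proj₁ csA))) αb∈D)
    where
    αb∈D : prodGroup c A b B (α * b)
    αb∈D = 0# , α * b , proj₁ (⊡-subgroup c (proj₁ csB)) , (α , Aα , *-comm α b) , sym (+-identityˡ _)

  _≈_ : Z → Z → Set c
  _≈_ = _≈Z_ F

  ·-comm : ∀ x y → (x · y) ≈ (y · x)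
  ·-comm (a , _) (b , _) = coset-cong (*-comm a b) (⊞-comm , ⊞-comm)

  -- Associativity: both sides are abc + (abC + acB + bcA).
  ·-assoc : ∀ x y z → ((x · y) · z) ≈ (x · (y · z))
  ·-assoc (a , A , _) (b , B , _) (c , C , _) = coset-cong (*-assoc a b c) (into , outof)
    where
    regroup : ∀ z u v → (a * b) * z + c * (a * u + b * v) ≡ a * (b * z + c * u) + (b * c) * v
    regroup z u v = begin
      (a * b) * z + c * (a * u + b * v)          ≡⟨ cong₂ _+_ (*-assoc a b z) (distribˡ c (a * u) (b * v)) ⟩
      a * (b * z) + (c * (a * u) + c * (b * v))  ≡⟨ cong₂ (λ s t → a * (b * z) + (s + t)) cau≡acu cbv≡bcv ⟩
      a * (b * z) + (a * (c * u) + (b * c) * v)  ≡⟨ sym (+-assoc _ _ _) ⟩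
      (a * (b * z) + a * (c * u)) + (b * c) * v  ≡⟨ cong (_+ (b * c) * v) (sym (distribˡ a (b * z) (c * u))) ⟩
      a * (b * z + c * u) + (b * c) * v          ∎
      where
      open ≡-Reasoning
      cau≡acu : c * (a * u) ≡ a * (c * u)
      cau≡acu = trans (sym (*-assoc c a u)) (trans (cong (_* u) (*-comm c a)) (*-assoc a c u))
      cbv≡bcv : c * (b * v) ≡ (b * c) * v
      cbv≡bcv = trans (sym (*-assoc c b v)) (cong (_* v) (*-comm c b))
    into : prodGroup (a * b) (prodGroup a A b B) c C ⊆ prodGroup a A (b * c) (prodGroup b B c C)
    into (_ , _ , (z , Cz , refl) , (_ , (_ , _ , (u , Bu , refl) , (v , Av , refl) , refl) , refl) , refl) =
      a * (b * z + c * u) , (b * c) * v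
      , (b * z + c * u , (b * z , c * u , (z , Cz , refl) , (u , Bu , refl) , refl) , refl)
      , (v , Av , refl) , regroup z u v
    outof : prodGroup a A (b * c) (prodGroup b B c C) ⊆ prodGroup (a * b) (prodGroup a A b B) c C
    outof (_ , _ , (_ , (_ , _ , (z , Cz , refl) , (u , Bu , refl) , refl) , refl) , (v , Av , refl) , refl) =
      (a * b) * z , c * (a * u + b * v) , (z , Cz , refl)
      , (a * u + b * v , (a * u , b * v , (u , Bu , refl) , (v , Av , refl) , refl) , refl)
      , sym (regroup z u v)

  -- Well-definedness: the product only depends on the sets.  If
  -- a + A = a' + A' then A = A' and a = a' + α with α ∈ A'.
  ·-congˡ : ∀ x x' y → x ≈ x' → (x · y) ≈ (x' · y)
  ·-congˡ (a , A , csA , _) x'@(a' , A' , csA' , _) (b , B , csB , _) x≈x'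
    with coset-≐ (proj₁ csA) (proj₁ csA') x≈x'
  ... | A≐A' , α , A'α , refl =
    ≐-trans (coset-cong refl (⊞-cong ≐-refl (⊡-cong b A≐A')))
            (change-rep csA' (rep∉group x') csB A'α)

  -- Congruence in both arguments follows by commutativity.
  ·-cong : ∀ {x x' y y'} → x ≈ x' → y ≈ y' → (x · y) ≈ (x' · y')
  ·-cong {x} {x'} {y} {y'} x≈x' y≈y' =
    ≐-trans (·-congˡ x x' y x≈x')
      (≐-trans (·-comm x' y) (≐-trans (·-congˡ y y' x' y≈y') (·-comm y' x')))

  ·-isCommutativeSemigroup : IsCommutativeSemigroup _≈_ _·_
  ·-isCommutativeSemigroup = record
    { isSemigroup = record
      { isMagma = record
        { isEquivalence = On.isEquivalence (toSet F) ≐-isEquivalence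
        ; ∙-cong = λ {x} {x'} {y} {y'} → ·-cong {x} {x'} {y} {y'} }
      ; assoc = ·-assoc }
    ; comm = ·-comm }

  -- The cosets b + (b a⁻¹)A
  -- with b ≠ 0 are zeroless, and they multiply like their representatives:
  -- (b + (b a⁻¹)A)(c + (c a⁻¹)A) = bc + (bc a⁻¹)A.  So they form a group
  -- containing a + A = a + (a a⁻¹)A.
  module Ray (a : Carrier) (A : Sub) (csA : IsCS A) (a∉A : ¬ A a) where
    a≢0 : a ≢ 0#
    a≢0 = rep-nonzero (proj₁ csA) a∉A
    a⁻¹ : Carrier
    a⁻¹ = inv a a≢0

    grp : Carrier → Sub
    grp k = (k * a⁻¹) ⊡ A

    rescale : ∀ k m → k ⊡ grp m ≐ grp (k * m)
    rescale k m = ≐-trans (⊡-⊡ k (m * a⁻¹)) (⊡-≡ (sym (*-assoc k m a⁻¹)))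

    -- k + (k a⁻¹)A is zeroless: k = (k a⁻¹) u forces u = a.
    ray : (k : Carrier) → k ≢ 0# → Z
    ray k k≢0 = mkZ k (grp k) (⊡-convex _ (*-nonzero k≢0 (inv-nonzero a a≢0)) csA) k∉grp
      where
      k∉grp : ¬ grp k k
      k∉grp (u , Au , k≡ka⁻¹u) = a∉A (subst A (sym a≡u) Au)
        where
        1≡a⁻¹u : 1# ≡ a⁻¹ * u
        1≡a⁻¹u = *-cancelˡ k≢0 (trans (*-identityʳ k) (trans k≡ka⁻¹u (*-assoc k a⁻¹ u)))
        a≡u : a ≡ u
        a≡u = trans (sym (*-identityʳ a)) (trans (cong (a *_) 1≡a⁻¹u) (*-inv-cancel a a≢0 u))

    rep : Z → Carrier
    rep (b , _) = b

    G : Pred Z (Level.suc c ⊔ ℓ)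
    G (b , B , _) = Lift (Level.suc c ⊔ ℓ) (B ≐ grp b)

    G-group : ∀ {b c' B C} → B ≐ grp b → C ≐ grp c' → prodGroup b B c' C ≐ grp (b * c')
    G-group {b} {c'} {B} {C} B≐ C≐ = ⊞-absorb (⊡-subgroup _ (proj₁ csA)) bC≐ c'B≐
      where
      bC≐ : b ⊡ C ≐ grp (b * c')
      bC≐ = ≐-trans (⊡-cong b C≐) (rescale b c')
      c'B≐ : c' ⊡ B ≐ grp (b * c')
      c'B≐ = ≐-trans (⊡-cong c' B≐) (≐-trans (rescale c' b) (⊡-≡ (cong (_* a⁻¹) (*-comm c' b))))

    G-closed : ∀ g h → G g → G h → G (g · h)
    G-closed _ _ (lift B≐) (lift C≐) = lift (G-group B≐ C≐)

    G-· : ∀ g h k → G g → G h → G k → rep g * rep h ≡ rep k → (g · h) ≈ k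
    G-· _ _ _ (lift B≐) (lift C≐) (lift D≐) refl = coset-cong refl (≐-trans (G-group B≐ C≐) (≐-sym D≐))

    one : Z
    one = ray 1# (λ 1≡0 → 0≢1 (sym 1≡0))

    G-inverse : ∀ g → G g → ∃[ h ] (G h × ((g · h) ≈ one) × ((h · g) ≈ one))
    G-inverse g@(b , _ , csB , zeroless) Gg = h , lift ≐-refl
      , G-· g h one Gg (lift ≐-refl) (lift ≐-refl) (inv-r b b≢0)
      , G-· h g one (lift ≐-refl) Gg (lift ≐-refl) (inv-l b b≢0)
      where
      b≢0 : b ≢ 0#
      b≢0 = rep-nonzero (proj₁ csB) (zeroless⇒notin csB zeroless)
      h : Z
      h = ray (inv b b≢0) (inv-nonzero b b≢0)

    G-subgroup : IsSubgroupOf _≈_ _·_ G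
    G-subgroup = G-closed , one , lift ≐-refl
      , (λ g Gg → G-· one g g (lift ≐-refl) Gg Gg (*-identityˡ (rep g))
                , G-· g one g Gg (lift ≐-refl) Gg (*-identityʳ (rep g)))
      , G-inverse

    a∈G : (zeroless : ¬ IsCS (coset F a A)) → G (a , A , csA , zeroless)
    a∈G _ = lift (≐-sym (≐-trans (⊡-≡ (inv-r a a≢0)) 1⊡))

  ·-completelyRegular : CompletelyRegular _≈_ _·_
  ·-completelyRegular x@(a , A , csA , zeroless) = G , G-subgroup , a∈G zeroless
    where open Ray a A csA (rep∉group x)

proposition3p3 : ∀ {c ℓ} (F : OrderedField c ℓ) → NonArchimedean F →
    Σ[ _·_ ∈ (Zeroless F → Zeroless F → Zeroless F) ]
    ((∀ x y → toSet F (x · y) ≐ mulSet F x y) ×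
    IsCommutativeSemigroup (_≈Z_ F) _·_ ×
    CompletelyRegular (_≈Z_ F) _·_)
proposition3p3 F _ = _·_ , toSet-· , ·-isCommutativeSemigroup , ·-completelyRegular
  where open ZerolessProduct F
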